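{- There exists an online algorithm that converts an arbitrary solution (schedule) of an MPMD-Size-MTS instance into a monotone schedule of the same or less cost.
   Context: Consider an instance of MPMD-Set with size-based delay: metric $(V,d)$, requests arriving online at discrete timesteps, $R_i$ the set of requests arrived up to and including timestep $i$, and delay functions $f_i$ on sets of requests with $f_i(\emptyset)=0$, $f_i(U)$ depending only on $|U|$ and non-decreasing in $|U|$. The associated MTS instance (MPMD-Size-MTS) has as states the even-sized subsets of the arrived requests (a state represents the set of matched requests), with initial state $\emptyset$. The transition graph $G$ has an edge between states $S$ and $S'$ whenever $S = S'\cup\{r,r'\}$ for two distinct requests $r,r'\notin S'$, with cost $d(r,r')$; the transition cost $c(S,S')$ between two states is the length of a shortest path between them in $G$. There is one task per timestep $i$, and processing it in state $S$ costs $f_i(R_i\setminus S)$. A schedule $\sigma=(S_0=\emptyset,S_1,\dots,S_T)$ has cost $\sum_{i=0}^{T-1}\big(c(S_i,S_{i+1}) + f_i(R_i\setminus S_i)\big)$. A schedule is monotone if $S_{i-1}\subseteq S_i$ for all $i$. An online conversion algorithm must output $S'_i$ upon seeing $S_1,\dots,S_i$ (and the instance revealed so far).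
   Formalization: The distances of the metric $(V,d)$ and the delay functions $f_i$ take rational values instead of real ones. -}

module Defs where

open import Data.Nat as ℕ using (ℕ; zero; suc; _≡ᵇ_)
open import Data.Nat.Divisibility using (_∣_)
open import Data.Bool using (Bool; true; false; _∨_; not; if_then_else_)
open import Data.Rational as ℚ using (ℚ; 0ℚ)
open import Data.Product using (Σ; _×_; _,_)
open import Relation.Binary.PropositionalEquality using (_≡_; _≢_)

-- A state (set of requests) is a characteristic function on request ids.
-- Requests are identified by ℕ in arrival order: request k is the k-th
-- request ever released; R_i = { k | k < count i }.
State : Set
State = ℕ → Bool

size : ℕ → State → ℕ
size zero    P = 0
size (suc n) P = size n P ℕ.+ (if P n then 1 else 0)

Below : ℕ → State → Set
Below n S = ∀ k → S k ≡ true → k ℕ.< n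

Vertex : ℕ → State → Set
Vertex n S = Below n S × (2 ∣ size n S)

Edge : State → State → ℕ → ℕ → Set
Edge S S' r r' =
  (r ≢ r') × (S' r ≡ false) × (S' r' ≡ false) ×
  (∀ k → S k ≡ (S' k ∨ ((k ≡ᵇ r) ∨ (k ≡ᵇ r'))))

IsMetric : {V : Set} → (V → V → ℚ) → Set
IsMetric {V} d =
  (∀ x y → 0ℚ ℚ.≤ d x y) ×
  (∀ x → d x x ≡ 0ℚ) ×
  (∀ x y → d x y ≡ 0ℚ → x ≡ y) ×
  (∀ x y → d x y ≡ d y x) ×
  (∀ x y z → d x z ℚ.≤ d x y ℚ.+ d y z)

-- An MPMD-Set instance with size-based delay (over point set V, without horizon).
record Instance (V : Set) : Set where
  field
    count      : ℕ → ℕ          -- |R_i|, number of requests arrived up to and including timestep i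
    count-mono : ∀ i → count i ℕ.≤ count (suc i)
    loc        : ℕ → V
    delay      : ℕ → ℕ → ℚ      -- f_i(U) = delay i |U|
    delay-zero : ∀ i → delay i 0 ≡ 0ℚ
    delay-mono : ∀ i s s' → s ℕ.≤ s' → delay i s ℚ.≤ delay i s'
open Instance public

module _ {V : Set} (d : V → V → ℚ) (I : Instance V) where

  unmatchedSize : ℕ → State → ℕ
  unmatchedSize i S = size (count I i) (λ k → not (S k))

  delayCost : ℕ → State → ℚ
  delayCost i S = delay I i (unmatchedSize i S)

  -- weighted paths in the transition graph G whose vertices are the
  -- even-sized subsets of {k < n}; edge {S' ∪ {r,r'}, S'} has weight d(r,r')
  data Path (n : ℕ) : State → State → ℚ → Set where
    stay    : ∀ {S S'} → Vertex n S → (∀ k → S k ≡ S' k) → Path n S S' 0ℚ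
    unmatch : ∀ {S S₁ S₂ x r r'} → Vertex n S → Edge S S₁ r r' →
              Path n S₁ S₂ x → Path n S S₂ (d (loc I r) (loc I r') ℚ.+ x)
    match   : ∀ {S S₁ S₂ x r r'} → Vertex n S → Edge S₁ S r r' →
              Path n S₁ S₂ x → Path n S S₂ (d (loc I r) (loc I r') ℚ.+ x)

  TransCost : ℕ → State → State → ℚ → Set
  TransCost n S S' x = Path n S S' x × (∀ y → Path n S S' y → x ℚ.≤ y)

  -- x = Σ_{i<T} ( c(S_i,S_{i+1}) + f_i(R_i \ S_i) ), where the transition
  -- S_i → S_{i+1} is measured in G over the requests arrived by timestep i+1
  SchedCost : ℕ → (ℕ → State) → ℚ → Set
  SchedCost zero    σ x = x ≡ 0ℚ
  SchedCost (suc T) σ x =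
    Σ ℚ λ y → Σ ℚ λ c →
      SchedCost T σ y × TransCost (count I (suc T)) (σ T) (σ (suc T)) c ×
      (x ≡ y ℚ.+ (c ℚ.+ delayCost T (σ T)))

ValidSched : {V : Set} → Instance V → ℕ → (ℕ → State) → Set
ValidSched I T σ = (∀ k → σ 0 k ≡ false) × (∀ i → i ℕ.≤ T → Vertex (count I i) (σ i))

Monotone : ℕ → (ℕ → State) → Set
Monotone T σ = ∀ i → suc i ℕ.≤ T → ∀ k → σ i k ≡ true → σ (suc i) k ≡ true

AgreeUpTo : {V : Set} → ℕ → Instance V → Instance V → Set
AgreeUpTo i I J =
  (∀ j → j ℕ.≤ i → count I j ≡ count J j) ×
  (∀ k → k ℕ.< count I i → loc I k ≡ loc J k) ×
  (∀ j → j ℕ.≤ i → ∀ s → delay I j s ≡ delay J j s)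

SchedAgreeUpTo : ℕ → (ℕ → State) → (ℕ → State) → Set
SchedAgreeUpTo i σ τ = ∀ j → j ℕ.≤ i → ∀ k → σ j k ≡ τ j k

-- A conversion algorithm: A I σ i is the output S'_i.
Converter : Set → Set
Converter V = Instance V → (ℕ → State) → ℕ → State

Online : {V : Set} → Converter V → Set
Online {V} A = ∀ (I J : Instance V) σ τ i → AgreeUpTo i I J → SchedAgreeUpTo i σ τ →
               ∀ k → A I σ i k ≡ A J τ i k

module Submission where

-- The converter only ever adds pairs, so its schedule S′ is monotone. At step i+1 it takes a
-- minimum-cost perfect matching M* of S′ᵢ Δ Sᵢ₊₁ and adds to S′ᵢ the pairs of M* lying inside
-- Sᵢ₊₁. The invariant is a perfect matching M of S′ᵢ Δ Sᵢ such that the cost of S′ up to i plus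
-- cost(M) is at most the cost of S up to i. Each edge of a transition path of S flips the membership
-- of two requests r, r′ in the symmetric difference, and M can follow at extra cost d(r, r′): the
-- old partners of r and r′ are re-paired, which the triangle inequality pays for. Hence M* costs at
-- most cost(M) + c(Sᵢ, Sᵢ₊₁); the pairs it adds pay for the move of S′, and the remaining pairs
-- perfectly match S′ᵢ₊₁ Δ Sᵢ₊₁ and become the new M. None of them lies inside Sᵢ₊₁, so at least
-- half of S′ᵢ₊₁ Δ Sᵢ₊₁ lies in S′ᵢ₊₁ ∖ Sᵢ₊₁: S′ leaves no more requests unmatched than S, and its
-- delay cost is no larger either.

open import Defs
open import Data.Nat using (ℕ)
open import Data.Rational using (ℚ; _≤_)
open import Data.Product using (Σ; _×_)

open import Algebra.Bundles using (CommutativeMonoid)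
import Algebra.Properties.CommutativeSemigroup as CommutativeSemigroupProperties
open import Data.Bool using (Bool; true; false; _∧_; _∨_; not; _xor_; if_then_else_; T; T?)
import Data.Bool.Properties as 𝔹ₚ
open import Data.List using (List; []; _∷_; map; filterᵇ; upTo)
open import Data.List.Membership.Propositional using (_∈_)
open import Data.List.Membership.Propositional.Properties
  using (∈-map⁺; ∈-map⁻; ∈-filter⁺; ∈-filter⁻; ∈-upTo⁺; ∈-upTo⁻)
open import Data.List.Properties using (map-cong)
open import Data.List.Relation.Unary.All as All using (All)
open import Data.List.Relation.Unary.All.Properties using (all-filter; map⁺)
open import Data.List.Relation.Unary.Any using (here; there)
open import Data.Nat as ℕ using (zero; suc; _+_; _*_; _<_; _≡ᵇ_; _≟_; _≤′_; ≤′-refl; ≤′-step)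
open import Data.Nat.Divisibility using (_∣_; _∣0; ∣-refl; ∣1⇒≡1; ∣m∣n⇒∣m+n; ∣m+n∣m⇒∣n; m∣m*n)
import Data.Nat.Properties as ℕₚ
open import Data.Nat.Tactic.RingSolver using (solve-∀)
open import Data.Product using (_,_; proj₁; proj₂)
open import Data.Rational as ℚ using (0ℚ)
import Data.Rational.Properties as ℚₚ
open import Data.Rational.Solver using (module +-*-Solver)
open import Data.Sum using (_⊎_; inj₁; inj₂; [_,_]′)
open import Function using (_∘_; const; Equivalence)
open import Relation.Binary.Bundles using (DecTotalOrder)
open import Relation.Binary.PropositionalEquality
open import Relation.Nullary using (yes; no; contradiction)

open import Algebra.Construct.NaturalChoice.Min (DecTotalOrder.totalOrder ℚₚ.≤-decTotalOrder) using (⊓-sel)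
open import Data.List.Extrema (DecTotalOrder.totalOrder ℚₚ.≤-decTotalOrder)
  using (argmin; f[argmin]≤f[⊤]; f[argmin]≤f[xs]; argmin-sel)
open import Data.List.Extrema.Core (DecTotalOrder.totalOrder ℚₚ.≤-decTotalOrder) using (⊓ᴸ)
open CommutativeSemigroupProperties ℕₚ.+-commutativeSemigroup
  using () renaming (interchange to ℕ-interchange; x∙yz≈y∙xz to ℕ-x∙yz≈y∙xz)
open CommutativeSemigroupProperties (CommutativeMonoid.commutativeSemigroup ℚₚ.+-0-commutativeMonoid)
  using () renaming (x∙yz≈y∙xz to ℚ-x∙yz≈y∙xz)

-- Sets of requests

𝟙 : Bool → ℕ
𝟙 b = if b then 1 else 0

∅ : State
∅ _ = false

⁅_⁆ : ℕ → State
⁅ a ⁆ k = k ≡ᵇ a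

∁ : State → State
∁ P k = not (P k)

infixr 7 _∩_
infixr 6 _∪_ _Δ_
infixl 6 _∖_
infixl 8 _⊕_
infix 4 _⊆_

_∪_ _∩_ _∖_ _Δ_ : State → State → State
(P ∪ Q) k = P k ∨ Q k
(P ∩ Q) k = P k ∧ Q k
(P ∖ Q) k = P k ∧ not (Q k)
(P Δ Q) k = P k xor Q k

_⊆_ : State → State → Set
P ⊆ Q = ∀ k → P k ≡ true → Q k ≡ true

ends : ℕ × ℕ → State
ends (a , b) = ⁅ a ⁆ ∪ ⁅ b ⁆

_⊕_ : State → ℕ × ℕ → State
B ⊕ e = B Δ ends e

⁅⁆-true⇒≡ : ∀ {k a} → ⁅ a ⁆ k ≡ true → k ≡ a
⁅⁆-true⇒≡ {k} {a} k≡a = ℕₚ.≡ᵇ⇒≡ k a (Equivalence.from 𝔹ₚ.T-≡ k≡a)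

≡ᵇ-refl : ∀ k → (k ≡ᵇ k) ≡ true
≡ᵇ-refl k = Equivalence.to 𝔹ₚ.T-≡ (ℕₚ.≡⇒≡ᵇ k k refl)

≢⇒≡ᵇ-false : ∀ {k a} → k ≢ a → (k ≡ᵇ a) ≡ false
≢⇒≡ᵇ-false k≢a = 𝔹ₚ.¬-not (k≢a ∘ ⁅⁆-true⇒≡)

∨-true : ∀ x y → x ∨ y ≡ true → x ≡ true ⊎ y ≡ true
∨-true true  y _  = inj₁ refl
∨-true false y eq = inj₂ eq

xor-true : ∀ x → x xor true ≡ not x
xor-true false = refl
xor-true true  = refl

xor-⊆ : ∀ b t → (t ≡ true → b ≡ true) → b xor t ≡ true → b ≡ true
xor-⊆ b false _   eq = trans (sym (𝔹ₚ.xor-identityʳ b)) eq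
xor-⊆ b true  t⇒b _  = t⇒b refl

∨≡xor : ∀ x y → (y ≡ true → x ≡ false) → x ∨ y ≡ x xor y
∨≡xor x false _    = trans (𝔹ₚ.∨-identityʳ x) (sym (𝔹ₚ.xor-identityʳ x))
∨≡xor x true  y⇒¬x rewrite y⇒¬x refl = refl

ends-left : ∀ a b → ends (a , b) a ≡ true
ends-left a b = cong (_∨ ⁅ b ⁆ a) (≡ᵇ-refl a)

ends-right : ∀ a b → ends (a , b) b ≡ true
ends-right a b = trans (cong (⁅ a ⁆ b ∨_) (≡ᵇ-refl b)) (𝔹ₚ.∨-zeroʳ (⁅ a ⁆ b))

⁅⁆⊆ : ∀ {P a} → P a ≡ true → ⁅ a ⁆ ⊆ P
⁅⁆⊆ {P} Pa k k≡a = subst (λ j → P j ≡ true) (sym (⁅⁆-true⇒≡ k≡a)) Pa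

ends⊆ : ∀ {P a b} → P a ≡ true → P b ≡ true → ends (a , b) ⊆ P
ends⊆ {a = a} {b} Pa Pb k k∈ab with ∨-true (⁅ a ⁆ k) (⁅ b ⁆ k) k∈ab
... | inj₁ k≡a = ⁅⁆⊆ Pa k k≡a
... | inj₂ k≡b = ⁅⁆⊆ Pb k k≡b

⊕-comm : ∀ B a b → B ⊕ (a , b) ≗ B ⊕ (b , a)
⊕-comm B a b k = cong (B k xor_) (𝔹ₚ.∨-comm (⁅ a ⁆ k) (⁅ b ⁆ k))

⊕-involutive : ∀ B e → B ⊕ e ⊕ e ≗ B
⊕-involutive B e k = begin
  (B k xor ends e k) xor ends e k ≡⟨ 𝔹ₚ.xor-assoc (B k) _ _ ⟩
  B k xor (ends e k xor ends e k) ≡⟨ cong (B k xor_) (𝔹ₚ.xor-same (ends e k)) ⟩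
  B k xor false                   ≡⟨ 𝔹ₚ.xor-identityʳ (B k) ⟩
  B k                             ∎
  where open ≡-Reasoning

⊕-swap : ∀ {S S′} e → S ≗ S′ ⊕ e → S′ ≗ S ⊕ e
⊕-swap {S} {S′} e S≗ k = trans (sym (⊕-involutive S′ e k)) (cong (_xor ends e k) (sym (S≗ k)))

ends-chain : ∀ {a b c} → a ≢ b → b ≢ c → a ≢ c →
             ∀ k → ends (a , b) k xor ends (b , c) k ≡ ends (a , c) k
ends-chain {a} {b} {c} a≢b b≢c a≢c k with k ≟ a | k ≟ b | k ≟ c
... | yes refl | _        | _        rewrite ≡ᵇ-refl k | ≢⇒≡ᵇ-false a≢b | ≢⇒≡ᵇ-false a≢c = refl
... | no k≢a   | yes refl | _        rewrite ≡ᵇ-refl k | ≢⇒≡ᵇ-false k≢a | ≢⇒≡ᵇ-false b≢c = refl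
... | no k≢a   | no k≢b   | yes refl rewrite ≡ᵇ-refl k | ≢⇒≡ᵇ-false k≢a | ≢⇒≡ᵇ-false k≢b = refl
... | no k≢a   | no k≢b   | no k≢c
  rewrite ≢⇒≡ᵇ-false k≢a | ≢⇒≡ᵇ-false k≢b | ≢⇒≡ᵇ-false k≢c = refl

⊕-chain : ∀ {a b c} B → a ≢ b → b ≢ c → a ≢ c → B ⊕ (a , b) ⊕ (b , c) ≗ B ⊕ (a , c)
⊕-chain B a≢b b≢c a≢c k =
  trans (𝔹ₚ.xor-assoc (B k) _ _) (cong (B k xor_) (ends-chain a≢b b≢c a≢c k))

Δ-resp-⊕ : ∀ {S S₁} X e → S₁ ≗ S ⊕ e → X Δ S₁ ≗ (X Δ S) ⊕ e
Δ-resp-⊕ X e S₁≗ k = trans (cong (X k xor_) (S₁≗ k)) (sym (𝔹ₚ.xor-assoc (X k) _ _))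

⊕-at-left : ∀ B a b → B a ≡ true → (B ⊕ (a , b)) a ≡ false
⊕-at-left B a b Ba rewrite ≡ᵇ-refl a | Ba = refl

⊕-at-right : ∀ B a b → B b ≡ true → (B ⊕ (a , b)) b ≡ false
⊕-at-right B a b Bb rewrite ≡ᵇ-refl b | 𝔹ₚ.∨-zeroʳ (⁅ a ⁆ b) | Bb = refl

⊕-outside : ∀ {a b k} B → k ≢ a → k ≢ b → (B ⊕ (a , b)) k ≡ B k
⊕-outside B k≢a k≢b rewrite ≢⇒≡ᵇ-false k≢a | ≢⇒≡ᵇ-false k≢b = 𝔹ₚ.xor-identityʳ _

⊕-⊆ : ∀ {B} e → ends e ⊆ B → B ⊕ e ⊆ B
⊕-⊆ {B} e e⊆B k = xor-⊆ (B k) (ends e k) (e⊆B k)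

Below-pred : ∀ {n B} → Below (suc n) B → B n ≡ false → Below n B
Below-pred {n} {B} below Bn k Bk = ℕₚ.≤∧≢⇒< (ℕₚ.m<1+n⇒m≤n (below k Bk)) k≢n
  where
  k≢n : k ≢ n
  k≢n refl = contradiction (trans (sym Bk) Bn) λ ()

Below-⊕ : ∀ {n B j} → Below (suc n) B → B n ≡ true → B j ≡ true → Below n (B ⊕ (n , j))
Below-⊕ {n} {B} {j} below Bn Bj =
  Below-pred (λ k k∈ → below k (⊕-⊆ (n , j) (ends⊆ Bn Bj) k k∈)) (⊕-at-left B n j Bn)

Below-Δ : ∀ {n X Y} → Below n X → Below n Y → Below n (X Δ Y)
Below-Δ {X = X} belowX belowY k k∈ with X k in Xk
... | true  = belowX k Xk
... | false = belowY k k∈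

Edge⇒⊕ : ∀ {S S′ r r′} → Edge S S′ r r′ → S ≗ S′ ⊕ (r , r′)
Edge⇒⊕ {S} {S′} {r} {r′} (_ , S′r , S′r′ , S≡) k =
  trans (S≡ k) (∨≡xor (S′ k) (ends (r , r′) k) λ k∈rr′ →
    𝔹ₚ.not-injective (ends⊆ {∁ S′} (cong not S′r) (cong not S′r′) k k∈rr′))

-- Counting

size-cong : ∀ n {P Q : State} → (∀ k → k < n → P k ≡ Q k) → size n P ≡ size n Q
size-cong zero    eq = refl
size-cong (suc n) eq =
  cong₂ _+_ (size-cong n (λ k k<n → eq k (ℕₚ.m<n⇒m<1+n k<n))) (cong 𝟙 (eq n (ℕₚ.n<1+n n)))

size-∅ : ∀ n → size n ∅ ≡ 0
size-∅ zero    = refl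
size-∅ (suc n) = trans (ℕₚ.+-identityʳ _) (size-∅ n)

size-stable : ∀ {m n P} → Below m P → m ≤′ n → size n P ≡ size m P
size-stable below ≤′-refl = refl
size-stable {P = P} below (≤′-step {n} m≤′n) with P n in Pn
... | true  = contradiction (ℕₚ.≤′⇒≤ m≤′n) (ℕₚ.<⇒≱ (below n Pn))
... | false = trans (ℕₚ.+-identityʳ _) (size-stable below m≤′n)

size≢0⇒nonempty : ∀ n P → size n P ≢ 0 → Σ ℕ λ j → j < n × P j ≡ true
size≢0⇒nonempty zero    P size≢0 = contradiction refl size≢0
size≢0⇒nonempty (suc n) P size≢0 with P n in Pn
... | true  = n , ℕₚ.n<1+n n , Pn
... | false with size≢0⇒nonempty n P (size≢0 ∘ trans (ℕₚ.+-identityʳ _))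
...   | j , j<n , Pj = j , ℕₚ.m<n⇒m<1+n j<n , Pj

size-remove : ∀ {n a} P → a < n → size n P ≡ 𝟙 (P a) + size n (P ∖ ⁅ a ⁆)
size-remove {suc n} {a} P a<1+n with ℕₚ.m<1+n⇒m<n∨m≡n a<1+n
... | inj₁ a<n rewrite ≢⇒≡ᵇ-false (ℕₚ.<⇒≢ a<n ∘ sym) | 𝔹ₚ.∧-identityʳ (P n) =
  trans (cong (_+ 𝟙 (P n)) (size-remove P a<n)) (ℕₚ.+-assoc (𝟙 (P a)) _ _)
... | inj₂ refl rewrite ≡ᵇ-refl a | 𝔹ₚ.∧-zeroʳ (P a) = begin
  size a P + 𝟙 (P a)                 ≡⟨ ℕₚ.+-comm (size a P) _ ⟩
  𝟙 (P a) + size a P                 ≡⟨ cong (𝟙 (P a) +_) (size-cong a below-a) ⟩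
  𝟙 (P a) + size a (P ∖ ⁅ a ⁆)       ≡⟨ cong (𝟙 (P a) +_) (ℕₚ.+-identityʳ _) ⟨
  𝟙 (P a) + (size a (P ∖ ⁅ a ⁆) + 0) ∎
  where
  open ≡-Reasoning
  below-a : ∀ k → k < a → P k ≡ (P ∖ ⁅ a ⁆) k
  below-a k k<a rewrite ≢⇒≡ᵇ-false (ℕₚ.<⇒≢ k<a) = sym (𝔹ₚ.∧-identityʳ (P k))

∩-remove-both : ∀ p c x y → (x ≡ true → c ≡ true) → (y ≡ true → c ≡ true) →
                ((p ∧ c) ∧ not x) ∧ not y ≡ p ∧ (c xor (x ∨ y))
∩-remove-both p c false false _  _  =
  trans (𝔹ₚ.∧-identityʳ _) (trans (𝔹ₚ.∧-identityʳ _) (cong (p ∧_) (sym (𝔹ₚ.xor-identityʳ c))))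
∩-remove-both p c true  y     cx _  rewrite cx refl =
  trans (cong (λ z → z ∧ not y) (𝔹ₚ.∧-zeroʳ (p ∧ true))) (sym (𝔹ₚ.∧-zeroʳ p))
∩-remove-both p c false true  _  cy rewrite cy refl =
  trans (𝔹ₚ.∧-zeroʳ _) (sym (𝔹ₚ.∧-zeroʳ p))

size-∩-⊕ : ∀ {n a b} P C → a < n → b < n → a ≢ b → C a ≡ true → C b ≡ true →
           size n (P ∩ C) ≡ 𝟙 (P a) + 𝟙 (P b) + size n (P ∩ C ⊕ (a , b))
size-∩-⊕ {n} {a} {b} P C a<n b<n a≢b Ca Cb = begin
  size n (P ∩ C)
    ≡⟨ size-remove (P ∩ C) a<n ⟩
  𝟙 (P a ∧ C a) + size n (P ∩ C ∖ ⁅ a ⁆)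
    ≡⟨ cong (𝟙 (P a ∧ C a) +_) (size-remove (P ∩ C ∖ ⁅ a ⁆) b<n) ⟩
  𝟙 (P a ∧ C a) + (𝟙 ((P ∩ C ∖ ⁅ a ⁆) b) + size n (P ∩ C ∖ ⁅ a ⁆ ∖ ⁅ b ⁆))
    ≡⟨ cong₂ (λ u v → 𝟙 u + (𝟙 v + size n (P ∩ C ∖ ⁅ a ⁆ ∖ ⁅ b ⁆))) Pa∧Ca Pb∧Cb∖a ⟩
  𝟙 (P a) + (𝟙 (P b) + size n (P ∩ C ∖ ⁅ a ⁆ ∖ ⁅ b ⁆))
    ≡⟨ ℕₚ.+-assoc (𝟙 (P a)) _ _ ⟨
  𝟙 (P a) + 𝟙 (P b) + size n (P ∩ C ∖ ⁅ a ⁆ ∖ ⁅ b ⁆)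
    ≡⟨ cong (𝟙 (P a) + 𝟙 (P b) +_) (size-cong n λ k _ →
         ∩-remove-both (P k) (C k) (⁅ a ⁆ k) (⁅ b ⁆ k) (⁅⁆⊆ Ca k) (⁅⁆⊆ Cb k)) ⟩
  𝟙 (P a) + 𝟙 (P b) + size n (P ∩ C ⊕ (a , b))
    ∎
  where
  open ≡-Reasoning
  Pa∧Ca : P a ∧ C a ≡ P a
  Pa∧Ca rewrite Ca = 𝔹ₚ.∧-identityʳ (P a)
  Pb∧Cb∖a : (P ∩ C ∖ ⁅ a ⁆) b ≡ P b
  Pb∧Cb∖a rewrite Cb | ≢⇒≡ᵇ-false (a≢b ∘ sym) =
    trans (𝔹ₚ.∧-identityʳ _) (𝔹ₚ.∧-identityʳ (P b))

size-⊕ : ∀ {n a b} C → a < n → b < n → a ≢ b → C a ≡ true → C b ≡ true →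
         size n C ≡ 2 + size n (C ⊕ (a , b))
size-⊕ C = size-∩-⊕ (λ _ → true) C

𝟙-∧-split : ∀ p q → 𝟙 p ≡ 𝟙 (p ∧ q) + 𝟙 (p ∧ not q)
𝟙-∧-split false q     = refl
𝟙-∧-split true  false = refl
𝟙-∧-split true  true  = refl

size-split : ∀ n P Q → size n P ≡ size n (P ∩ Q) + size n (P ∖ Q)
size-split zero    P Q = refl
size-split (suc n) P Q =
  trans (cong₂ _+_ (size-split n P Q) (𝟙-∧-split (P n) (Q n)))
        (ℕ-interchange (size n (P ∩ Q)) (size n (P ∖ Q)) (𝟙 (P n ∧ Q n)) (𝟙 (P n ∧ not (Q n))))

𝟙-xor : ∀ x y → 𝟙 (x xor y) + 2 * 𝟙 (x ∧ y) ≡ 𝟙 x + 𝟙 y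
𝟙-xor false false = refl
𝟙-xor false true  = refl
𝟙-xor true  false = refl
𝟙-xor true  true  = refl

size-Δ : ∀ n X Y → size n (X Δ Y) + 2 * size n (X ∩ Y) ≡ size n X + size n Y
size-Δ zero    X Y = refl
size-Δ (suc n) X Y = begin
  size n (X Δ Y) + 𝟙 (X n xor Y n) + 2 * (size n (X ∩ Y) + 𝟙 (X n ∧ Y n))
    ≡⟨ regroup (size n (X Δ Y)) (𝟙 (X n xor Y n)) (size n (X ∩ Y)) (𝟙 (X n ∧ Y n)) ⟩
  (size n (X Δ Y) + 2 * size n (X ∩ Y)) + (𝟙 (X n xor Y n) + 2 * 𝟙 (X n ∧ Y n))
    ≡⟨ cong₂ _+_ (size-Δ n X Y) (𝟙-xor (X n) (Y n)) ⟩
  (size n X + size n Y) + (𝟙 (X n) + 𝟙 (Y n))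
    ≡⟨ ℕ-interchange (size n X) (size n Y) (𝟙 (X n)) (𝟙 (Y n)) ⟩
  size n X + 𝟙 (X n) + (size n Y + 𝟙 (Y n))
    ∎
  where
  open ≡-Reasoning
  regroup : ∀ a b c d → a + b + 2 * (c + d) ≡ (a + 2 * c) + (b + 2 * d)
  regroup = solve-∀

even-Δ : ∀ n X Y → 2 ∣ size n X → 2 ∣ size n Y → 2 ∣ size n (X Δ Y)
even-Δ n X Y 2∣X 2∣Y =
  ∣m+n∣m⇒∣n (subst (2 ∣_) (ℕₚ.+-comm (size n (X Δ Y)) _) 2∣Δ+2∩) (m∣m*n (size n (X ∩ Y)))
  where
  2∣Δ+2∩ : 2 ∣ size n (X Δ Y) + 2 * size n (X ∩ Y)
  2∣Δ+2∩ = subst (2 ∣_) (sym (size-Δ n X Y)) (∣m∣n⇒∣m+n 2∣X 2∣Y)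

Vertex-mono : ∀ {m n S} → m ℕ.≤ n → Vertex m S → Vertex n S
Vertex-mono m≤n (below , even) =
  (λ k Sk → ℕₚ.<-≤-trans (below k Sk) m≤n) ,
  subst (2 ∣_) (sym (size-stable below (ℕₚ.≤⇒≤′ m≤n))) even

-- Perfect matchings

Matching : Set
Matching = List (ℕ × ℕ)

hits : ℕ → ℕ × ℕ → ℕ
hits k (a , b) = 𝟙 (⁅ a ⁆ k) + 𝟙 (⁅ b ⁆ k)

occ : ℕ → Matching → ℕ
occ k []      = 0
occ k (e ∷ M) = hits k e + occ k M

-- A record rather than a Π-type, so that M and B can be inferred from a proof.
record Covers (M : Matching) (B : State) : Set where
  constructor covers
  field occ≡ : ∀ k → occ k M ≡ 𝟙 (B k)
open Covers

𝟙≡0 : ∀ {b} → 𝟙 b ≡ 0 → b ≡ false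
𝟙≡0 {false} _ = refl

suc≡𝟙 : ∀ {m b} → suc m ≡ 𝟙 b → b ≡ true × m ≡ 0
suc≡𝟙 {b = true} refl = refl , refl

Covers-resp : ∀ {M B B′} → B ≗ B′ → Covers M B → Covers M B′
Covers-resp B≗B′ cov = covers λ k → trans (occ≡ cov k) (cong 𝟙 (B≗B′ k))

Covers-[] : ∀ {B} → Covers [] B → B ≗ ∅
Covers-[] cov k = 𝟙≡0 (sym (occ≡ cov k))

Covers-swap : ∀ {a b M B} → Covers ((a , b) ∷ M) B → Covers ((b , a) ∷ M) B
Covers-swap {a} {b} {M} cov = covers λ k → trans (cong (_+ occ k M) (ℕₚ.+-comm (𝟙 (⁅ b ⁆ k)) _)) (occ≡ cov k)

Covers-head : ∀ {a b M B} → Covers ((a , b) ∷ M) B → B a ≡ true × occ a M ≡ 0 × a ≢ b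
Covers-head {a} {b} {M} {B} cov
  with suc≡𝟙 (subst (λ x → 𝟙 x + 𝟙 (⁅ b ⁆ a) + occ a M ≡ 𝟙 (B a)) (≡ᵇ-refl a) (occ≡ cov a))
... | Ba , rest≡0 = Ba , ℕₚ.m+n≡0⇒n≡0 _ rest≡0 , a≢b
  where
  a≢b : a ≢ b
  a≢b refl = contradiction (trans (cong 𝟙 (sym (≡ᵇ-refl a))) (ℕₚ.m+n≡0⇒m≡0 _ rest≡0)) λ ()

Covers-uncons-head : ∀ {a b M B} → Covers ((a , b) ∷ M) B → occ a M ≡ 𝟙 ((B ⊕ (a , b)) a)
Covers-uncons-head {a} cov with Covers-head cov
... | Ba , occ≡0 , _ rewrite ≡ᵇ-refl a | Ba = occ≡0

Covers-uncons : ∀ {a b M B} → Covers ((a , b) ∷ M) B → Covers M (B ⊕ (a , b))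
Covers-uncons {a} {b} {M} {B} cov = covers occ≡⊕
  where
  open ≡-Reasoning
  occ≡⊕ : ∀ k → occ k M ≡ 𝟙 ((B ⊕ (a , b)) k)
  occ≡⊕ k with k ≟ a | k ≟ b
  ... | yes refl | _        = Covers-uncons-head cov
  ... | no _     | yes refl = trans (Covers-uncons-head (Covers-swap cov)) (cong 𝟙 (⊕-comm B b a k))
  ... | no k≢a   | no k≢b   = begin
    occ k M
      ≡⟨ cong₂ (λ x y → 𝟙 x + 𝟙 y + occ k M) (≢⇒≡ᵇ-false k≢a) (≢⇒≡ᵇ-false k≢b) ⟨
    hits k (a , b) + occ k M
      ≡⟨ occ≡ cov k ⟩
    𝟙 (B k)
      ≡⟨ cong 𝟙 (⊕-outside B k≢a k≢b) ⟨
    𝟙 ((B ⊕ (a , b)) k)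
      ∎

Covers-cons : ∀ {a b M B} → a ≢ b → B a ≡ false → B b ≡ false → Covers M B →
              Covers ((a , b) ∷ M) (B ⊕ (a , b))
Covers-cons {a} {b} {M} {B} a≢b Ba Bb cov = covers occ≡⊕
  where
  occ≡⊕ : ∀ k → hits k (a , b) + occ k M ≡ 𝟙 ((B ⊕ (a , b)) k)
  occ≡⊕ k with k ≟ a | k ≟ b
  ... | yes refl | _        rewrite ≡ᵇ-refl k | ≢⇒≡ᵇ-false a≢b | occ≡ cov k | Ba = refl
  ... | no k≢a   | yes refl rewrite ≢⇒≡ᵇ-false k≢a | ≡ᵇ-refl k | occ≡ cov k | Bb = refl
  ... | no k≢a   | no k≢b
    rewrite ≢⇒≡ᵇ-false k≢a | ≢⇒≡ᵇ-false k≢b | 𝔹ₚ.xor-identityʳ (B k) = occ≡ cov k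

support : Matching → State
support M k = occ k M ≡ᵇ 1

𝟙-split : ∀ m n b → m + n ≡ 𝟙 b →
          m ≡ 𝟙 (m ≡ᵇ 1) × n ≡ 𝟙 (b ∧ not (m ≡ᵇ 1)) × ((m ≡ᵇ 1) ≡ true → b ≡ true)
𝟙-split zero          n b eq = refl , trans eq (cong 𝟙 (sym (𝔹ₚ.∧-identityʳ b))) , λ ()
𝟙-split (suc zero)    n b eq with suc≡𝟙 eq
... | refl , refl = refl , refl , λ _ → refl
𝟙-split (suc (suc m)) n b eq with suc≡𝟙 eq
... | _ , ()

occ-filter : ∀ p k M → occ k M ≡ occ k (filterᵇ p M) + occ k (filterᵇ (not ∘ p) M)
occ-filter p k []      = refl
occ-filter p k (e ∷ M) with p e
... | true  = trans (cong (hits k e +_) (occ-filter p k M)) (sym (ℕₚ.+-assoc (hits k e) (occ k (filterᵇ p M)) _))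
... | false = trans (cong (hits k e +_) (occ-filter p k M)) (ℕ-x∙yz≈y∙xz (hits k e) (occ k (filterᵇ p M)) _)

module _ {M B} (p : ℕ × ℕ → Bool) (cov : Covers M B) where
  private
    split : ∀ k → occ k (filterᵇ p M) ≡ 𝟙 (support (filterᵇ p M) k) ×
                  occ k (filterᵇ (not ∘ p) M) ≡ 𝟙 ((B ∖ support (filterᵇ p M)) k) ×
                  (support (filterᵇ p M) k ≡ true → B k ≡ true)
    split k = 𝟙-split (occ k (filterᵇ p M)) _ (B k) (trans (sym (occ-filter p k M)) (occ≡ cov k))

  Covers-filter : Covers (filterᵇ p M) (support (filterᵇ p M))
  Covers-filter = covers λ k → proj₁ (split k)

  Covers-filter-rest : Covers (filterᵇ (not ∘ p) M) (B ∖ support (filterᵇ p M))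
  Covers-filter-rest = covers λ k → proj₁ (proj₂ (split k))

  support-filter⊆ : support (filterᵇ p M) ⊆ B
  support-filter⊆ k = proj₂ (proj₂ (split k))

support⊆ : ∀ {M Y} → All (λ e → ends e ⊆ Y) M → support M ⊆ Y
support⊆ {M} {Y} M⊆Y k k∈ =
  occ⇒∈ M M⊆Y (ℕₚ.≤-reflexive (sym (ℕₚ.≡ᵇ⇒≡ _ 1 (Equivalence.from 𝔹ₚ.T-≡ k∈))))
  where
  occ⇒∈ : ∀ M → All (λ e → ends e ⊆ Y) M → 1 ℕ.≤ occ k M → Y k ≡ true
  occ⇒∈ ((a , b) ∷ M) (e⊆ All.∷ M⊆) 1≤occ with ⁅ a ⁆ k in k≡a | ⁅ b ⁆ k in k≡b
  ... | true  | _     = e⊆ k (cong (_∨ ⁅ b ⁆ k) k≡a)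
  ... | false | true  = e⊆ k (cong₂ _∨_ k≡a k≡b)
  ... | false | false = occ⇒∈ M M⊆ 1≤occ

insideᵇ : State → ℕ × ℕ → Bool
insideᵇ Y (a , b) = Y a ∧ Y b

inside⇒ends⊆ : ∀ {Y} e → T (insideᵇ Y e) → ends e ⊆ Y
inside⇒ends⊆ {Y} (a , b) inside with Y a in Ya | Y b in Yb
... | true | true = ends⊆ Ya Yb

𝟙-not-both : ∀ x y → x ∧ y ≡ false → 𝟙 x + 𝟙 y ℕ.≤ 𝟙 (not x) + 𝟙 (not y)
𝟙-not-both false false _ = ℕ.z≤n
𝟙-not-both false true  _ = ℕₚ.≤-refl
𝟙-not-both true  false _ = ℕₚ.≤-refl

size-∩≤size-∁∩ : ∀ n {L C} Y → Covers L C → Below n C → All (λ e → insideᵇ Y e ≡ false) L →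
                 size n (Y ∩ C) ℕ.≤ size n (∁ Y ∩ C)
size-∩≤size-∁∩ n {[]} {C} Y cov _ _ = ℕₚ.≤-trans (ℕₚ.≤-reflexive size≡0) ℕ.z≤n
  where
  size≡0 : size n (Y ∩ C) ≡ 0
  size≡0 = trans (size-cong n λ k _ → trans (cong (Y k ∧_) (Covers-[] cov k)) (𝔹ₚ.∧-zeroʳ (Y k))) (size-∅ n)
size-∩≤size-∁∩ n {(a , b) ∷ L} {C} Y cov below (outside All.∷ L-outside)
  with Covers-head cov | Covers-head (Covers-swap cov)
... | Ca , _ , a≢b | Cb , _ , _ = begin
  size n (Y ∩ C)
    ≡⟨ size-∩-⊕ Y C a<n b<n a≢b Ca Cb ⟩
  𝟙 (Y a) + 𝟙 (Y b) + size n (Y ∩ C ⊕ (a , b))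
    ≤⟨ ℕₚ.+-mono-≤ (𝟙-not-both (Y a) (Y b) outside)
                   (size-∩≤size-∁∩ n Y (Covers-uncons cov) below′ L-outside) ⟩
  𝟙 (not (Y a)) + 𝟙 (not (Y b)) + size n (∁ Y ∩ C ⊕ (a , b))
    ≡⟨ size-∩-⊕ (∁ Y) C a<n b<n a≢b Ca Cb ⟨
  size n (∁ Y ∩ C)
    ∎
  where
  open ℕₚ.≤-Reasoning
  a<n = below a Ca
  b<n = below b Cb
  below′ : Below n (C ⊕ (a , b))
  below′ k k∈ = below k (⊕-⊆ (a , b) (ends⊆ Ca Cb) k k∈)

-- Minimum-cost perfect matchings

p≤p+q : ∀ p {q} → 0ℚ ≤ q → p ≤ p ℚ.+ q
p≤p+q p 0≤q = subst (_≤ p ℚ.+ _) (ℚₚ.+-identityʳ p) (ℚₚ.+-monoʳ-≤ p 0≤q)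

p≤q+p : ∀ p {q} → 0ℚ ≤ q → p ≤ q ℚ.+ p
p≤q+p p {q} 0≤q = subst (p ≤_) (ℚₚ.+-comm p q) (p≤p+q p 0≤q)

cost : (ℕ → ℕ → ℚ) → Matching → ℚ
cost w []            = 0ℚ
cost w ((a , b) ∷ M) = w a b ℚ.+ cost w M

cost-filter : ∀ w p M → cost w M ≡ cost w (filterᵇ p M) ℚ.+ cost w (filterᵇ (not ∘ p) M)
cost-filter w p []            = sym (ℚₚ.+-identityʳ 0ℚ)
cost-filter w p ((a , b) ∷ M) with p (a , b)
... | true  = trans (cong (w a b ℚ.+_) (cost-filter w p M)) (sym (ℚₚ.+-assoc (w a b) (cost w (filterᵇ p M)) _))
... | false = trans (cong (w a b ℚ.+_) (cost-filter w p M)) (ℚ-x∙yz≈y∙xz (w a b) (cost w (filterᵇ p M)) _)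

record IsPseudometric (w : ℕ → ℕ → ℚ) : Set where
  field
    nonneg    : ∀ a b → 0ℚ ≤ w a b
    symmetric : ∀ a b → w a b ≡ w b a
    triangle  : ∀ a b c → w a c ≤ w a b ℚ.+ w b c

pickMin : (ℕ → ℕ → ℚ) → List Matching → Matching
pickMin w []       = []
pickMin w (M ∷ Ms) = argmin (cost w) M Ms

pickMin-≤ : ∀ w {M Ms} → M ∈ Ms → cost w (pickMin w Ms) ≤ cost w M
pickMin-≤ w {Ms = M ∷ Ms}  (here refl) = f[argmin]≤f[⊤] {f = cost w} M Ms
pickMin-≤ w {Ms = M′ ∷ Ms} (there M∈)  = All.lookup (f[argmin]≤f[xs] {f = cost w} M′ Ms) M∈

pickMin-∈ : ∀ w {M Ms} → M ∈ Ms → pickMin w Ms ∈ Ms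
pickMin-∈ w {Ms = M′ ∷ Ms} _ with argmin-sel (cost w) M′ Ms
... | inj₁ ≡M′ = here ≡M′
... | inj₂ ∈Ms = there ∈Ms

pickMin-all : ∀ {P : Matching → Set} w Ms → P [] → All P Ms → P (pickMin w Ms)
pickMin-all w []       P[] _   = P[]
pickMin-all w (M ∷ Ms) _   PMs = All.lookup PMs (pickMin-∈ w (here refl))

partners : ℕ → State → List ℕ
partners n B = filterᵇ B (upTo n)

∈-partners⁺ : ∀ {n B j} → j < n → B j ≡ true → j ∈ partners n B
∈-partners⁺ {B = B} j<n Bj = ∈-filter⁺ (T? ∘ B) (∈-upTo⁺ j<n) (Equivalence.from 𝔹ₚ.T-≡ Bj)

∈-partners⁻ : ∀ {n B j} → j ∈ partners n B → j < n × B j ≡ true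
∈-partners⁻ {B = B} j∈ with ∈-filter⁻ (T? ∘ B) j∈
... | j∈upTo , Bj = ∈-upTo⁻ j∈upTo , Equivalence.to 𝔹ₚ.T-≡ Bj

mutual
  minMatching : (ℕ → ℕ → ℚ) → ℕ → State → Matching
  minMatching w zero    B = []
  minMatching w (suc n) B = if B n then pickMin w (candidates w n B) else minMatching w n B

  candidates : (ℕ → ℕ → ℚ) → ℕ → State → List Matching
  candidates w n B = map (candidate w n B) (partners n B)

  candidate : (ℕ → ℕ → ℚ) → ℕ → State → ℕ → Matching
  candidate w n B j = (n , j) ∷ minMatching w n (B ⊕ (n , j))

minMatching-covers : ∀ w n B → Below n B → 2 ∣ size n B → Covers (minMatching w n B) B
minMatching-covers w zero    B below _ = covers λ k → cong 𝟙 (sym (B≗∅ k))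
  where
  B≗∅ : B ≗ ∅
  B≗∅ k with B k in Bk
  ... | true  = contradiction (below k Bk) λ ()
  ... | false = refl
minMatching-covers w (suc n) B below even with B n in Bn
... | false = minMatching-covers w n B (Below-pred below Bn) (subst (2 ∣_) (ℕₚ.+-identityʳ _) even)
... | true
  with size≢0⇒nonempty n B (λ size≡0 → contradiction (∣1⇒≡1 (subst (λ s → 2 ∣ s + 1) size≡0 even)) λ ())
...   | j , j<n , Bj
  with ∈-map⁻ (candidate w n B) (pickMin-∈ w (∈-map⁺ (candidate w n B) (∈-partners⁺ {B = B} j<n Bj)))
...     | i , i∈ , pick≡ = subst (λ M → Covers M B) (sym pick≡) candidate-covers
  where
  i<n = proj₁ (∈-partners⁻ {n} {B} i∈)
  Bi  = proj₂ (∈-partners⁻ {n} {B} i∈)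
  n≢i : n ≢ i
  n≢i = ℕₚ.<⇒≢ i<n ∘ sym
  B′ = B ⊕ (n , i)
  size≡ : size (suc n) B ≡ 2 + size n B′
  size≡ = begin
    size (suc n) B             ≡⟨ size-⊕ B (ℕₚ.n<1+n n) (ℕₚ.m<n⇒m<1+n i<n) n≢i Bn Bi ⟩
    2 + (size n B′ + 𝟙 (B′ n)) ≡⟨ cong (λ x → 2 + (size n B′ + 𝟙 x)) (⊕-at-left B n i Bn) ⟩
    2 + (size n B′ + 0)        ≡⟨ cong (2 +_) (ℕₚ.+-identityʳ _) ⟩
    2 + size n B′              ∎
    where open ≡-Reasoning
  even′ : 2 ∣ size n B′
  even′ = ∣m+n∣m⇒∣n (subst (2 ∣_) size≡ (subst (λ x → 2 ∣ size n B + 𝟙 x) (sym Bn) even)) ∣-refl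
  candidate-covers : Covers (candidate w n B i) B
  candidate-covers =
    Covers-resp (⊕-involutive B (n , i))
      (Covers-cons n≢i (⊕-at-left B n i Bn) (⊕-at-right B n i Bi)
        (minMatching-covers w n B′ (Below-⊕ below Bn Bi) even′))

module Costs {w : ℕ → ℕ → ℚ} (w-pseudometric : IsPseudometric w) where
  open IsPseudometric w-pseudometric

  cost-nonneg : ∀ M → 0ℚ ≤ cost w M
  cost-nonneg []            = ℚₚ.≤-refl
  cost-nonneg ((a , b) ∷ M) = ℚₚ.+-mono-≤ (nonneg a b) (cost-nonneg M)

  extract-pair : ∀ r M → 1 ℕ.≤ occ r M →
                 Σ ℕ λ p → Σ Matching λ M₀ →
                   (∀ k → occ k M ≡ occ k ((r , p) ∷ M₀)) × cost w M ≡ cost w ((r , p) ∷ M₀)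
  extract-pair r ((a , b) ∷ M) r∈ with r ≟ a | r ≟ b
  ... | yes refl | _        = b , M , (λ k → refl) , refl
  ... | no _     | yes refl =
    a , M , (λ k → cong (_+ occ k M) (ℕₚ.+-comm (𝟙 (⁅ a ⁆ k)) _)) , cong (ℚ._+ cost w M) (symmetric a r)
  ... | no r≢a   | no r≢b
    with extract-pair r M
           (subst₂ (λ x y → 1 ℕ.≤ 𝟙 x + 𝟙 y + occ r M) (≢⇒≡ᵇ-false r≢a) (≢⇒≡ᵇ-false r≢b) r∈)
  ...   | p , M₀ , occ≡′ , cost≡ =
    p , (a , b) ∷ M₀ ,
    (λ k → trans (cong (hits k (a , b) +_) (occ≡′ k))
                 (ℕ-x∙yz≈y∙xz (hits k (a , b)) (hits k (r , p)) (occ k M₀))) ,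
    trans (cong (w a b ℚ.+_) cost≡) (ℚ-x∙yz≈y∙xz (w a b) (w r p) (cost w M₀))

  Covers-extract : ∀ {r M B} → Covers M B → B r ≡ true →
                   Σ ℕ λ p → Σ Matching λ M₀ →
                     Covers ((r , p) ∷ M₀) B × cost w M ≡ w r p ℚ.+ cost w M₀
  Covers-extract {r} {M} cov Br with extract-pair r M (ℕₚ.≤-reflexive (sym (trans (occ≡ cov r) (cong 𝟙 Br))))
  ... | p , M₀ , occ≡′ , cost≡ = p , M₀ , covers (λ k → trans (sym (occ≡′ k)) (occ≡ cov k)) , cost≡

  CoverWithin : State → ℚ → Set
  CoverWithin B c = Σ Matching λ M → Covers M B × cost w M ≤ c

  CoverWithin-resp : ∀ {B B′ c c′} → B ≗ B′ → c ≤ c′ → CoverWithin B c → CoverWithin B′ c′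
  CoverWithin-resp B≗B′ c≤c′ (M , cov , M≤c) = M , Covers-resp B≗B′ cov , ℚₚ.≤-trans M≤c c≤c′

  rematch-free : ∀ {r r′ M B} → r ≢ r′ → B r ≡ false → B r′ ≡ false → Covers M B →
                 CoverWithin (B ⊕ (r , r′)) (cost w M ℚ.+ w r r′)
  rematch-free {r} {r′} {M} r≢r′ Br Br′ cov =
    (r , r′) ∷ M , Covers-cons r≢r′ Br Br′ cov , ℚₚ.≤-reflexive (ℚₚ.+-comm (w r r′) (cost w M))

  rematch-matched : ∀ {r r′ M B} → r ≢ r′ → B r ≡ true → B r′ ≡ false → Covers M B →
                    CoverWithin (B ⊕ (r , r′)) (cost w M ℚ.+ w r r′)
  rematch-matched {r} {r′} {M} {B} r≢r′ Br Br′ cov with Covers-extract cov Br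
  ... | p , M₀ , cov′ , cost≡ with Covers-head cov′ | Covers-head (Covers-swap cov′)
  ...   | _ , _ , r≢p | Bp , _ , _ =
    CoverWithin-resp (⊕-chain B r≢p p≢r′ r≢r′) cost-bound
      (rematch-free p≢r′ (⊕-at-right B r p Bp) (trans (⊕-outside B (≢-sym r≢r′) (≢-sym p≢r′)) Br′)
        (Covers-uncons cov′))
    where
    p≢r′ : p ≢ r′
    p≢r′ refl = contradiction (trans (sym Bp) Br′) λ ()
    cost-bound : cost w M₀ ℚ.+ w p r′ ≤ cost w M ℚ.+ w r r′
    cost-bound = begin
      cost w M₀ ℚ.+ w p r′             ≤⟨ ℚₚ.+-monoʳ-≤ (cost w M₀) (triangle p r r′) ⟩
      cost w M₀ ℚ.+ (w p r ℚ.+ w r r′) ≡⟨ cong (λ x → cost w M₀ ℚ.+ (x ℚ.+ w r r′)) (symmetric p r) ⟩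
      cost w M₀ ℚ.+ (w r p ℚ.+ w r r′) ≡⟨ regroup (cost w M₀) (w r p) (w r r′) ⟩
      (w r p ℚ.+ cost w M₀) ℚ.+ w r r′ ≡⟨ cong (ℚ._+ w r r′) cost≡ ⟨
      cost w M ℚ.+ w r r′              ∎
      where
      open ℚₚ.≤-Reasoning
      open +-*-Solver
      regroup : ∀ a b c → a ℚ.+ (b ℚ.+ c) ≡ (b ℚ.+ a) ℚ.+ c
      regroup = solve 3 (λ a b c → a :+ (b :+ c) := (b :+ a) :+ c) refl

  rematch : ∀ {r r′ M B} → r ≢ r′ → Covers M B → CoverWithin (B ⊕ (r , r′)) (cost w M ℚ.+ w r r′)
  rematch {r} {r′} {M} {B} r≢r′ cov with B r in Br | B r′ in Br′
  ... | false | false = rematch-free r≢r′ Br Br′ cov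
  ... | true  | false = rematch-matched r≢r′ Br Br′ cov
  ... | false | true  =
    CoverWithin-resp (⊕-comm B r′ r) (ℚₚ.≤-reflexive (cong (cost w M ℚ.+_) (symmetric r′ r)))
      (rematch-matched (≢-sym r≢r′) Br′ Br cov)
  ... | true  | true  with Covers-extract cov Br
  ...   | p , M₀ , cov′ , cost≡ with p ≟ r′
  ...     | yes refl = M₀ , Covers-uncons cov′ , M₀≤
    where
    M₀≤ : cost w M₀ ≤ cost w M ℚ.+ w r p
    M₀≤ = begin
      cost w M₀           ≤⟨ p≤q+p (cost w M₀) (nonneg r p) ⟩
      w r p ℚ.+ cost w M₀ ≡⟨ cost≡ ⟨
      cost w M            ≤⟨ p≤p+q (cost w M) (nonneg r p) ⟩
      cost w M ℚ.+ w r p  ∎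
      where open ℚₚ.≤-Reasoning
  ...     | no p≢r′ with Covers-head cov′
  ...       | _ , _ , r≢p =
    CoverWithin-resp (λ k → trans (⊕-comm (B ⊕ (r , p)) r′ p k) (⊕-chain B r≢p p≢r′ r≢r′ k)) cost-bound
      (rematch-matched (≢-sym p≢r′) (trans (⊕-outside B (≢-sym r≢r′) (≢-sym p≢r′)) Br′)
        (⊕-at-right B r p (proj₁ (Covers-head (Covers-swap cov′)))) (Covers-uncons cov′))
    where
    cost-bound : cost w M₀ ℚ.+ w r′ p ≤ cost w M ℚ.+ w r r′
    cost-bound = begin
      cost w M₀ ℚ.+ w r′ p             ≤⟨ ℚₚ.+-monoʳ-≤ (cost w M₀) (triangle r′ r p) ⟩
      cost w M₀ ℚ.+ (w r′ r ℚ.+ w r p) ≡⟨ cong (λ x → cost w M₀ ℚ.+ (x ℚ.+ w r p)) (symmetric r′ r) ⟩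
      cost w M₀ ℚ.+ (w r r′ ℚ.+ w r p) ≡⟨ regroup (cost w M₀) (w r r′) (w r p) ⟩
      (w r p ℚ.+ cost w M₀) ℚ.+ w r r′ ≡⟨ cong (ℚ._+ w r r′) cost≡ ⟨
      cost w M ℚ.+ w r r′              ∎
      where
      open ℚₚ.≤-Reasoning
      open +-*-Solver
      regroup : ∀ a b c → a ℚ.+ (b ℚ.+ c) ≡ (c ℚ.+ a) ℚ.+ b
      regroup = solve 3 (λ a b c → a :+ (b :+ c) := (c :+ a) :+ b) refl

  minMatching-minimal : ∀ n {B M} → Below n B → Covers M B → cost w (minMatching w n B) ≤ cost w M
  minMatching-minimal zero    {M = M} _ _ = cost-nonneg M
  minMatching-minimal (suc n) {B} {M} below cov with B n in Bn
  ... | false = minMatching-minimal n (Below-pred below Bn) cov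
  ... | true  with Covers-extract cov Bn
  ...   | p , M₀ , cov′ , cost≡ = begin
    cost w (pickMin w (candidates w n B))
      ≤⟨ pickMin-≤ w (∈-map⁺ (candidate w n B) (∈-partners⁺ p<n Bp)) ⟩
    w n p ℚ.+ cost w (minMatching w n (B ⊕ (n , p)))
      ≤⟨ ℚₚ.+-monoʳ-≤ (w n p) (minMatching-minimal n (Below-⊕ below Bn Bp) (Covers-uncons cov′)) ⟩
    w n p ℚ.+ cost w M₀
      ≡⟨ cost≡ ⟨
    cost w M
      ∎
    where
    open ℚₚ.≤-Reasoning
    Bp : B p ≡ true
    Bp = proj₁ (Covers-head (Covers-swap cov′))
    p<n : p < n
    p<n = ℕₚ.≤∧≢⇒< (ℕₚ.m<1+n⇒m≤n (below p Bp)) (≢-sym (proj₂ (proj₂ (Covers-head cov′))))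

-- Paths in the transition graph

weight : {V : Set} → (V → V → ℚ) → Instance V → ℕ → ℕ → ℚ
weight d I a b = d (loc I a) (loc I b)

weight-pseudometric : ∀ {V} {d : V → V → ℚ} → IsMetric d → (I : Instance V) → IsPseudometric (weight d I)
weight-pseudometric (nonneg , _ , _ , symmetric , triangle) I = record
  { nonneg    = λ a b → nonneg (loc I a) (loc I b)
  ; symmetric = λ a b → symmetric (loc I a) (loc I b)
  ; triangle  = λ a b c → triangle (loc I a) (loc I b) (loc I c)
  }

∪-ends-⊕ : ∀ w t → (t ≡ true → w ≡ false) → (w ∨ t) xor t ≡ w
∪-ends-⊕ w false _    = trans (𝔹ₚ.xor-identityʳ _) (𝔹ₚ.∨-identityʳ w)
∪-ends-⊕ w true  t⇒¬w rewrite t⇒¬w refl = refl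

∪-ends-shift : ∀ w c t → (t ≡ true → c ≡ true) → (w ∨ t) ∨ (c xor t) ≡ w ∨ c
∪-ends-shift w c false _   = cong₂ _∨_ (𝔹ₚ.∨-identityʳ w) (𝔹ₚ.xor-identityʳ c)
∪-ends-shift w c true  t⇒c rewrite t⇒c refl | 𝔹ₚ.∨-zeroʳ w = refl

∪-ends-disjoint : ∀ w c t → (t ≡ true → c ≡ true) → (c ≡ true → not w ≡ true) → c xor t ≡ true →
                  not (w ∨ t) ≡ true
∪-ends-disjoint w c false _   c⇒¬w c≡ rewrite 𝔹ₚ.∨-identityʳ w =
  c⇒¬w (trans (sym (𝔹ₚ.xor-identityʳ c)) c≡)
∪-ends-disjoint w c true  t⇒c _    c≡ rewrite t⇒c refl = contradiction c≡ λ ()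

module Paths {V : Set} (d : V → V → ℚ) (I : Instance V) where

  Path-end : ∀ {n S S′ x} → Path d I n S S′ x → Vertex n S′
  Path-end {n} (stay (below , even) S≗S′) =
    (λ k S′k → below k (trans (S≗S′ k) S′k)) , subst (2 ∣_) (size-cong n λ k _ → S≗S′ k) even
  Path-end (unmatch _ _ P) = Path-end P
  Path-end (match   _ _ P) = Path-end P

  Path-union : ∀ {n W D Z} L → Vertex n W → Covers L D → Below n D → D ⊆ ∁ W → W ∪ D ≗ Z →
               Path d I n W Z (cost (weight d I) L)
  Path-union {W = W} [] vW cov _ _ W∪D≗Z =
    stay vW λ k → trans (sym (trans (cong (W k ∨_) (Covers-[] cov k)) (𝔹ₚ.∨-identityʳ (W k)))) (W∪D≗Z k)
  Path-union {n} {W} {D} ((a , b) ∷ L) (belowW , evenW) cov belowD D⊆∁W W∪D≗Z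
    with Covers-head cov | Covers-head (Covers-swap cov)
  ... | Da , _ , a≢b | Db , _ , _ =
    match (belowW , evenW) (a≢b , Wa , Wb , λ k → refl)
      (Path-union L (belowW′ , evenW′) (Covers-uncons cov) belowD′
        (λ k → ∪-ends-disjoint (W k) (D k) (ends (a , b) k) (ends⊆ Da Db k) (D⊆∁W k))
        (λ k → trans (∪-ends-shift (W k) (D k) (ends (a , b) k) (ends⊆ Da Db k)) (W∪D≗Z k)))
    where
    Wa = 𝔹ₚ.not-injective (D⊆∁W a Da)
    Wb = 𝔹ₚ.not-injective (D⊆∁W b Db)
    W′ = W ∪ ends (a , b)
    belowW′ : Below n W′
    belowW′ k k∈ with ∨-true (W k) (ends (a , b) k) k∈
    ... | inj₁ Wk  = belowW k Wk
    ... | inj₂ k∈e = belowD k (ends⊆ Da Db k k∈e)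
    size≡ : size n W′ ≡ 2 + size n W
    size≡ = trans (size-⊕ W′ (belowD a Da) (belowD b Db) a≢b
                    (trans (cong (W a ∨_) (ends-left a b)) (𝔹ₚ.∨-zeroʳ (W a)))
                    (trans (cong (W b ∨_) (ends-right a b)) (𝔹ₚ.∨-zeroʳ (W b))))
                  (cong (2 +_) (size-cong n λ k _ →
                    ∪-ends-⊕ (W k) (ends (a , b) k) λ k∈e →
                      𝔹ₚ.not-injective (D⊆∁W k (ends⊆ Da Db k k∈e))))
    evenW′ : 2 ∣ size n W′
    evenW′ = subst (2 ∣_) (sym size≡) (∣m∣n⇒∣m+n ∣-refl evenW)
    belowD′ : Below n (D ⊕ (a , b))
    belowD′ k k∈ = belowD k (⊕-⊆ (a , b) (ends⊆ Da Db) k k∈)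

module PathCovers {V : Set} {d : V → V → ℚ} (d-metric : IsMetric d) (I : Instance V) where
  open Costs (weight-pseudometric d-metric I)

  Path⇒CoverWithin : ∀ {n S S′ x M} X → Path d I n S S′ x → Covers M (X Δ S) →
                     CoverWithin (X Δ S′) (cost (weight d I) M ℚ.+ x)
  edge-step : ∀ {n S S₁ S₂ x r r′ M} X → r ≢ r′ → S₁ ≗ S ⊕ (r , r′) → Path d I n S₁ S₂ x →
              Covers M (X Δ S) → CoverWithin (X Δ S₂) (cost (weight d I) M ℚ.+ (weight d I r r′ ℚ.+ x))

  Path⇒CoverWithin {M = M} X (stay _ S≗S′) cov =
    M , Covers-resp (λ k → cong (X k xor_) (S≗S′ k)) cov , ℚₚ.≤-reflexive (sym (ℚₚ.+-identityʳ _))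
  Path⇒CoverWithin X (unmatch _ edge P) cov = edge-step X (proj₁ edge) (⊕-swap _ (Edge⇒⊕ edge)) P cov
  Path⇒CoverWithin X (match   _ edge P) cov = edge-step X (proj₁ edge) (Edge⇒⊕ edge) P cov

  edge-step {S = S} {x = x} {r} {r′} {M} X r≢r′ S₁≗ P cov with rematch r≢r′ cov
  ... | M₁ , cov₁ , M₁≤ =
    CoverWithin-resp (λ _ → refl) bound
      (Path⇒CoverWithin X P (Covers-resp (λ k → sym (Δ-resp-⊕ {S} X (r , r′) S₁≗ k)) cov₁))
    where
    bound : cost (weight d I) M₁ ℚ.+ x ≤ cost (weight d I) M ℚ.+ (weight d I r r′ ℚ.+ x)
    bound = ℚₚ.≤-trans (ℚₚ.+-monoˡ-≤ x M₁≤)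
                       (ℚₚ.≤-reflexive (ℚₚ.+-assoc (cost (weight d I) M) (weight d I r r′) x))

-- The converter

newPairs : (ℕ → ℕ → ℚ) → ℕ → State → State → Matching
newPairs w n X Y = filterᵇ (insideᵇ Y) (minMatching w n (X Δ Y))

pendingPairs : (ℕ → ℕ → ℚ) → ℕ → State → State → Matching
pendingPairs w n X Y = filterᵇ (not ∘ insideᵇ Y) (minMatching w n (X Δ Y))

step : (ℕ → ℕ → ℚ) → ℕ → State → State → State
step w n X Y = X ∪ support (newPairs w n X Y)

step-⊇ : ∀ w n X Y → X ⊆ step w n X Y
step-⊇ w n X Y k Xk = cong (_∨ support (newPairs w n X Y) k) Xk

convert : {V : Set} → (V → V → ℚ) → Converter V
convert d I σ zero    = ∅
convert d I σ (suc i) = step (weight d I) (count I (suc i)) (convert d I σ i) (σ (suc i))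

xor-true⇒not : ∀ x y → x xor y ≡ true → y ≡ true → not x ≡ true
xor-true⇒not false true _ _ = refl

Δ-∖-new : ∀ x y s → (s ≡ true → y ≡ true) → (x xor y) ∧ not s ≡ (x ∨ s) xor y
Δ-∖-new x y false _   = trans (𝔹ₚ.∧-identityʳ _) (cong (_xor y) (sym (𝔹ₚ.∨-identityʳ x)))
Δ-∖-new x y true  s⇒y rewrite s⇒y refl | 𝔹ₚ.∨-zeroʳ x = 𝔹ₚ.∧-zeroʳ _

∁∩≡∩Δ : ∀ z y → not z ∧ y ≡ y ∧ (z xor y)
∁∩≡∩Δ z false = 𝔹ₚ.∧-zeroʳ (not z)
∁∩≡∩Δ z true  = trans (𝔹ₚ.∧-identityʳ (not z)) (sym (xor-true z))

∁∩Δ≡∁∩ : ∀ z y → not y ∧ (z xor y) ≡ not y ∧ z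
∁∩Δ≡∁∩ z false = 𝔹ₚ.xor-identityʳ z
∁∩Δ≡∁∩ z true  = refl

module Step {V : Set} {d : V → V → ℚ} (d-metric : IsMetric d) (I : Instance V)
            {n X Y} (vX : Vertex n X) (vY : Vertex n Y) where
  open Paths d I
  open Costs (weight-pseudometric d-metric I)

  private
    w   = weight d I
    M*  = minMatching w n (X Δ Y)
    new = newPairs w n X Y
    Z   = step w n X Y

    below-Δ : Below n (X Δ Y)
    below-Δ = Below-Δ (proj₁ vX) (proj₁ vY)

    M*-covers : Covers M* (X Δ Y)
    M*-covers = minMatching-covers w n (X Δ Y) below-Δ (even-Δ n X Y (proj₂ vX) (proj₂ vY))

    new⊆Δ : support new ⊆ X Δ Y
    new⊆Δ = support-filter⊆ (insideᵇ Y) M*-covers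

    new⊆Y : support new ⊆ Y
    new⊆Y = support⊆ (All.map (λ {e} → inside⇒ends⊆ e) (all-filter (T? ∘ insideᵇ Y) M*))

    new⊆∁X : support new ⊆ ∁ X
    new⊆∁X k k∈ = xor-true⇒not (X k) (Y k) (new⊆Δ k k∈) (new⊆Y k k∈)

  step-path : Path d I n X Z (cost w new)
  step-path = Path-union new vX (Covers-filter (insideᵇ Y) M*-covers) (λ k k∈ → below-Δ k (new⊆Δ k k∈))
                new⊆∁X (λ k → refl)

  step-vertex : Vertex n Z
  step-vertex = Path-end step-path

  pendingPairs-covers : Covers (pendingPairs w n X Y) (Z Δ Y)
  pendingPairs-covers = Covers-resp (λ k → Δ-∖-new (X k) (Y k) (support new k) (new⊆Y k))
                                    (Covers-filter-rest (insideᵇ Y) M*-covers)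

  minMatching-optimal : ∀ {M} → Covers M (X Δ Y) → cost w M* ≤ cost w M
  minMatching-optimal = minMatching-minimal n below-Δ

  cost-minMatching : cost w M* ≡ cost w new ℚ.+ cost w (pendingPairs w n X Y)
  cost-minMatching = cost-filter w (insideᵇ Y) M*

  step-unmatched : size n (∁ Z) ℕ.≤ size n (∁ Y)
  step-unmatched = begin
    size n (∁ Z)
      ≡⟨ size-split n (∁ Z) Y ⟩
    size n (∁ Z ∩ Y) + size n (∁ Z ∖ Y)
      ≡⟨ cong (_+ size n (∁ Z ∖ Y)) (size-cong n λ k _ → ∁∩≡∩Δ (Z k) (Y k)) ⟩
    size n (Y ∩ (Z Δ Y)) + size n (∁ Z ∖ Y)
      ≤⟨ ℕₚ.+-monoˡ-≤ (size n (∁ Z ∖ Y)) Y∩≤∁Y∩ ⟩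
    size n (∁ Y ∩ (Z Δ Y)) + size n (∁ Z ∖ Y)
      ≡⟨ cong₂ _+_ (size-cong n λ k _ → ∁∩Δ≡∁∩ (Z k) (Y k))
                   (size-cong n λ k _ → 𝔹ₚ.∧-comm (not (Z k)) (not (Y k))) ⟩
    size n (∁ Y ∩ Z) + size n (∁ Y ∖ Z)
      ≡⟨ size-split n (∁ Y) Z ⟨
    size n (∁ Y)
      ∎
    where
    open ℕₚ.≤-Reasoning
    Y∩≤∁Y∩ : size n (Y ∩ (Z Δ Y)) ℕ.≤ size n (∁ Y ∩ (Z Δ Y))
    Y∩≤∁Y∩ = size-∩≤size-∁∩ n Y pendingPairs-covers (Below-Δ (proj₁ step-vertex) (proj₁ vY))
               (All.map (Equivalence.to 𝔹ₚ.T-not-≡) (all-filter (T? ∘ not ∘ insideᵇ Y) M*))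

module Conversion {V : Set} {d : V → V → ℚ} (d-metric : IsMetric d) (I : Instance V)
                  (σ : ℕ → State) (σ₀≗∅ : σ 0 ≗ ∅) where
  open PathCovers d-metric I

  private
    w = weight d I
    A = convert d I σ

  VerticesUpTo : ℕ → Set
  VerticesUpTo i = ∀ j → j ℕ.≤ i → Vertex (count I j) (σ j)

  VerticesUpTo-pred : ∀ {i} → VerticesUpTo (suc i) → VerticesUpTo i
  VerticesUpTo-pred vσ j j≤i = vσ j (ℕₚ.m≤n⇒m≤1+n j≤i)

  convert-vertex : ∀ i → VerticesUpTo i → Vertex (count I i) (A i)
  convert-vertex zero    _  = (λ k ()) , subst (2 ∣_) (sym (size-∅ (count I 0))) (2 ∣0)
  convert-vertex (suc i) vσ = step-vertex
    where
    open Step d-metric I (Vertex-mono (count-mono I i) (convert-vertex i (VerticesUpTo-pred vσ)))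
                         (vσ (suc i) ℕₚ.≤-refl)

  convert-unmatched : ∀ i → VerticesUpTo i → unmatchedSize d I i (A i) ℕ.≤ unmatchedSize d I i (σ i)
  convert-unmatched zero    _  = ℕₚ.≤-reflexive (size-cong (count I 0) λ k _ → cong not (sym (σ₀≗∅ k)))
  convert-unmatched (suc i) vσ = step-unmatched
    where
    open Step d-metric I (Vertex-mono (count-mono I i) (convert-vertex i (VerticesUpTo-pred vσ)))
                         (vσ (suc i) ℕₚ.≤-refl)

  cost-invariant : ∀ T → VerticesUpTo T → ∀ {x y} → SchedCost d I T σ x → SchedCost d I T A y →
                   Σ Matching λ M → Covers M (A T Δ σ T) × y ℚ.+ cost w M ≤ x
  cost-invariant zero    _ {x} {y} x≡0 y≡0 =
    [] , covers (λ k → cong 𝟙 (sym (σ₀≗∅ k))) ,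
    ℚₚ.≤-reflexive (trans (ℚₚ.+-identityʳ y) (trans y≡0 (sym x≡0)))
  cost-invariant (suc T) vσ {x} {y} (x₀ , c₁ , σ-cost , (σ-path , _) , x≡)
                                    (y₀ , c₂ , A-cost , (_ , c₂-min) , y≡)
    with cost-invariant T (VerticesUpTo-pred vσ) σ-cost A-cost
  ... | M , M-covers , y₀+M≤x₀ with Path⇒CoverWithin (A T) σ-path M-covers
  ...   | M₂ , M₂-covers , M₂≤ = pendingPairs w n (A T) (σ (suc T)) , pendingPairs-covers , bound
    where
    n = count I (suc T)
    open Step d-metric I (Vertex-mono (count-mono I T) (convert-vertex T (VerticesUpTo-pred vσ)))
                         (vσ (suc T) ℕₚ.≤-refl)
    new     = cost w (newPairs w n (A T) (σ (suc T)))
    pending = cost w (pendingPairs w n (A T) (σ (suc T)))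
    δ  = delayCost d I T (σ T)
    δ′ = delayCost d I T (A T)
    bound : y ℚ.+ pending ≤ x
    bound = begin
      y ℚ.+ pending
        ≡⟨ cong (ℚ._+ pending) y≡ ⟩
      (y₀ ℚ.+ (c₂ ℚ.+ δ′)) ℚ.+ pending
        ≤⟨ ℚₚ.+-monoˡ-≤ pending (ℚₚ.+-monoʳ-≤ y₀ (ℚₚ.+-mono-≤ (c₂-min _ step-path)
             (delay-mono I T _ _ (convert-unmatched T (VerticesUpTo-pred vσ))))) ⟩
      (y₀ ℚ.+ (new ℚ.+ δ)) ℚ.+ pending
        ≡⟨ regroup₁ y₀ new δ pending ⟩
      (y₀ ℚ.+ δ) ℚ.+ (new ℚ.+ pending)
        ≡⟨ cong ((y₀ ℚ.+ δ) ℚ.+_) cost-minMatching ⟨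
      (y₀ ℚ.+ δ) ℚ.+ cost w (minMatching w n (A T Δ σ (suc T)))
        ≤⟨ ℚₚ.+-monoʳ-≤ (y₀ ℚ.+ δ) (ℚₚ.≤-trans (minMatching-optimal M₂-covers) M₂≤) ⟩
      (y₀ ℚ.+ δ) ℚ.+ (cost w M ℚ.+ c₁)
        ≡⟨ regroup₂ y₀ δ (cost w M) c₁ ⟩
      (y₀ ℚ.+ cost w M) ℚ.+ (c₁ ℚ.+ δ)
        ≤⟨ ℚₚ.+-monoˡ-≤ (c₁ ℚ.+ δ) y₀+M≤x₀ ⟩
      x₀ ℚ.+ (c₁ ℚ.+ δ)
        ≡⟨ x≡ ⟨
      x ∎
      where
      open ℚₚ.≤-Reasoning
      open +-*-Solver
      regroup₁ : ∀ a b c e → (a ℚ.+ (b ℚ.+ c)) ℚ.+ e ≡ (a ℚ.+ c) ℚ.+ (b ℚ.+ e)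
      regroup₁ = solve 4 (λ a b c e → (a :+ (b :+ c)) :+ e := (a :+ c) :+ (b :+ e)) refl
      regroup₂ : ∀ a b c e → (a ℚ.+ b) ℚ.+ (c ℚ.+ e) ≡ (a ℚ.+ c) ℚ.+ (e ℚ.+ b)
      regroup₂ = solve 4 (λ a b c e → (a :+ b) :+ (c :+ e) := (a :+ c) :+ (e :+ b)) refl

-- Online

-- Relies on the library's definition of ⊓ᴸ, which inspects f only at its two arguments.
⊓ᴸ-cong : ∀ {A : Set} {f g : A → ℚ} x y → f x ≡ g x → f y ≡ g y → ⊓ᴸ f x y ≡ ⊓ᴸ g x y
⊓ᴸ-cong x y = cong₂ (λ u v → [ const x , const y ]′ (⊓-sel u v))

argmin-cong : ∀ {A : Set} {f g : A → ℚ} ⊤ xs → All (λ x → f x ≡ g x) (⊤ ∷ xs) →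
              argmin f ⊤ xs ≡ argmin g ⊤ xs
argmin-cong ⊤ []       _ = refl
argmin-cong {f = f} {g} ⊤ (x ∷ xs) (f⊤ All.∷ fx All.∷ fxs) =
  trans (⊓ᴸ-cong x (argmin f ⊤ xs) fx f≡g) (cong (⊓ᴸ g x) (argmin-cong ⊤ xs (f⊤ All.∷ fxs)))
  where
  f≡g : f (argmin f ⊤ xs) ≡ g (argmin f ⊤ xs)
  f≡g with argmin-sel f ⊤ xs
  ... | inj₁ ≡⊤  = subst (λ z → f z ≡ g z) (sym ≡⊤) f⊤
  ... | inj₂ ∈xs = All.lookup fxs ∈xs

pickMin-cong : ∀ {w w′} Ms → All (λ M → cost w M ≡ cost w′ M) Ms → pickMin w Ms ≡ pickMin w′ Ms
pickMin-cong []       _   = refl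
pickMin-cong (M ∷ Ms) eqs = argmin-cong M Ms eqs

filterᵇ-cong : ∀ {A : Set} {p q : A → Bool} → p ≗ q → ∀ xs → filterᵇ p xs ≡ filterᵇ q xs
filterᵇ-cong p≗q []       = refl
filterᵇ-cong {q = q} p≗q (x ∷ xs) rewrite p≗q x with q x
... | true  = cong (x ∷_) (filterᵇ-cong p≗q xs)
... | false = filterᵇ-cong p≗q xs

AgreeBelow : ℕ → (ℕ → ℕ → ℚ) → (ℕ → ℕ → ℚ) → Set
AgreeBelow n w w′ = ∀ a b → a < n → b < n → w a b ≡ w′ a b

AgreeBelow-pred : ∀ {n w w′} → AgreeBelow (suc n) w w′ → AgreeBelow n w w′
AgreeBelow-pred agree a b a<n b<n = agree a b (ℕₚ.m<n⇒m<1+n a<n) (ℕₚ.m<n⇒m<1+n b<n)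

minMatching-cong : ∀ n {w w′ B B′} → AgreeBelow n w w′ → B ≗ B′ →
                   minMatching w n B ≡ minMatching w′ n B′ ×
                   cost w (minMatching w n B) ≡ cost w′ (minMatching w n B)
minMatching-cong zero    _     _    = refl , refl
minMatching-cong (suc n) {w} {w′} {B} {B′} agree B≗B′ rewrite B≗B′ n with B′ n
... | false = minMatching-cong n (AgreeBelow-pred agree) B≗B′
... | true  = trans (pickMin-cong (candidates w n B) costs≡) (cong (pickMin w′) candidates≡) ,
              pickMin-all w (candidates w n B) refl costs≡
  where
  candidates≡ : candidates w n B ≡ candidates w′ n B′
  candidates≡ =
    trans (map-cong (λ j → cong ((n , j) ∷_)
                      (proj₁ (minMatching-cong n (AgreeBelow-pred agree) λ k → cong (_xor _) (B≗B′ k)))) _)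
          (cong (map (candidate w′ n B′)) (filterᵇ-cong B≗B′ (upTo n)))
  costs≡ : All (λ M → cost w M ≡ cost w′ M) (candidates w n B)
  costs≡ = map⁺ (All.tabulate λ {j} j∈ →
    cong₂ ℚ._+_ (agree n j (ℕₚ.n<1+n n) (ℕₚ.m<n⇒m<1+n (proj₁ (∈-partners⁻ {n} {B} j∈))))
                (proj₂ (minMatching-cong n {B = B ⊕ (n , j)} (AgreeBelow-pred agree) λ _ → refl)))

step-cong : ∀ n {w w′ X X′ Y Y′} → AgreeBelow n w w′ → X ≗ X′ → Y ≗ Y′ →
            step w n X Y ≗ step w′ n X′ Y′
step-cong n {w} {w′} {X} {X′} {Y} {Y′} agree X≗X′ Y≗Y′ k =
  cong₂ _∨_ (X≗X′ k) (cong (λ M → support M k) newPairs≡)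
  where
  newPairs≡ : newPairs w n X Y ≡ newPairs w′ n X′ Y′
  newPairs≡ =
    trans (cong (filterᵇ (insideᵇ Y))
                (proj₁ (minMatching-cong n agree λ j → cong₂ _xor_ (X≗X′ j) (Y≗Y′ j))))
          (filterᵇ-cong (λ (a , b) → cong₂ _∧_ (Y≗Y′ a) (Y≗Y′ b)) (minMatching w′ n (X′ Δ Y′)))

AgreeUpTo-pred : ∀ {V i} {I J : Instance V} → AgreeUpTo (suc i) I J → AgreeUpTo i I J
AgreeUpTo-pred {i = i} {I} (count≡ , loc≡ , delay≡) =
  (λ j j≤i → count≡ j (ℕₚ.m≤n⇒m≤1+n j≤i)) ,
  (λ k k< → loc≡ k (ℕₚ.<-≤-trans k< (count-mono I i))) ,
  (λ j j≤i → delay≡ j (ℕₚ.m≤n⇒m≤1+n j≤i))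

convert-online : ∀ {V} (d : V → V → ℚ) → Online (convert d)
convert-online d I J σ τ zero    _ _ k = refl
convert-online d I J σ τ (suc i) agree@(count≡ , loc≡ , _) σ≡τ k =
  trans (step-cong (count I (suc i)) (λ a b a< b< → cong₂ d (loc≡ a a<) (loc≡ b b<))
                   previous≡ (σ≡τ (suc i) ℕₚ.≤-refl) k)
        (cong (λ n → step (weight d J) n (convert d J τ i) (τ (suc i)) k) (count≡ (suc i) ℕₚ.≤-refl))
  where
  previous≡ : convert d I σ i ≗ convert d J τ i
  previous≡ = convert-online d I J σ τ i (AgreeUpTo-pred {I = I} {J} agree)
                             (λ j j≤i → σ≡τ j (ℕₚ.m≤n⇒m≤1+n j≤i))

lemma12 : (V : Set) (d : V → V → ℚ) → IsMetric d →
    Σ (Converter V) λ A → Online A ×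
      (∀ (I : Instance V) (T : ℕ) (σ : ℕ → State) → ValidSched I T σ →
        ValidSched I T (A I σ) × Monotone T (A I σ) ×
        (∀ x y → SchedCost d I T σ x → SchedCost d I T (A I σ) y → y ≤ x))
lemma12 V d d-metric = convert d , convert-online d , λ I T σ (σ₀≗∅ , vσ) →
  let open Conversion d-metric I σ σ₀≗∅
      open Costs (weight-pseudometric d-metric I) using (cost-nonneg)
  in ((λ _ → refl) , λ i i≤T → convert-vertex i λ j j≤i → vσ j (ℕₚ.≤-trans j≤i i≤T)) ,
     (λ i _ → step-⊇ (weight d I) (count I (suc i)) (convert d I σ i) (σ (suc i))) ,
     λ x y σ-cost A-cost →
       let (M , _ , y+M≤x) = cost-invariant T vσ σ-cost A-cost
       in ℚₚ.≤-trans (p≤p+q y (cost-nonneg M)) y+M≤x
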